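{- Let $\mathcal{C}$ be a class of instances closed under homomorphic equivalence. For every finite set $\mathcal{F}$ of connected instances, the following statements are equivalent. (1) $\mathcal{C}$ admits a left query algorithm over $\mathbb{N}$ of the form $(\mathcal{F},X)$ for some set $X$. (2) $\mathcal{C}$ admits a left query algorithm over $\mathbb{B}$ of the form $(\mathcal{F},X')$ for some set $X'$.
   Context: A schema is a finite set of relation symbols with positive arities. An instance $A$ assigns to each relation symbol $R$ of arity $r$ a finite $r$-ary relation $R^A$; $\mathrm{adom}(A)$ is the set of entries of its tuples. A homomorphism $h:A\to B$ is a map $\mathrm{adom}(A)\to\mathrm{adom}(B)$ mapping each tuple of $R^A$ to a tuple of $R^B$, for every $R$. $A,B$ are homomorphically equivalent if $A\to B$ and $B\to A$; a class is closed under homomorphic equivalence if it contains all instances homomorphically equivalent to its members. A class of instances is a collection of instances over a fixed schema closed under isomorphism. An instance $A$ is connected if for any $a,a'\in\mathrm{adom}(A)$ there is a sequence $a=a_0,\dots,a_n=a'$ of elements such that consecutive elements occur together in some fact (tuple) of $A$. $\hom_{\mathbb{N}}(A,B)$ is the number of homomorphisms $A\to B$; $\hom_{\mathbb{B}}(A,B)$ is $1$ if a homomorphism $A\to B$ exists and $0$ otherwise. For $K\in\{\mathbb{B},\mathbb{N}\}$ and $\mathcal{F}=\{F_1,\dots,F_k\}$, $\hom_K(\mathcal{F},D)=(\hom_K(F_1,D),\dots,\hom_K(F_k,D))$. A left query algorithm over $K$ for $\mathcal{C}$ of the form $(\mathcal{F},X)$ means $X$ is a set of $k$-tuples over $K$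 (over $\{0,1\}$ for $\mathbb{B}$, over the non-negative integers for $\mathbb{N}$) such that for every instance $D$: $D\in\mathcal{C}$ iff $\hom_K(\mathcal{F},D)\in X$. -}

module Defs where

open import Data.Nat using (ℕ; zero; suc; _≤_)
open import Data.Bool using (Bool; true; false; not; _∨_; _∧_; T)
open import Data.Fin using (Fin)
open import Data.Vec using (Vec; []; _∷_; lookup)
import Data.Vec as Vec
open import Data.List using (List; [_]; concatMap; length; filter; allFin)
open import Data.Bool.ListAction using (all; any)
import Data.List as List
open import Data.Product using (Σ; ∃; _×_; _,_)
open import Data.Vec.Membership.Propositional using (_∈_)
open import Relation.Binary.Construct.Closure.ReflexiveTransitive using (Star)
open import Relation.Nullary.Decidable using (Dec; yes; no)
open import Function.Bundles using (_⇔_)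
open import Level using (Level; _⊔_) renaming (suc to lsuc; zero to lzero)

record Schema : Set where
  field
    size      : ℕ
    arity     : Fin size → ℕ
    arity-pos : ∀ R → 1 ≤ arity R
open Schema public

allVecs : (m n : ℕ) → List (Vec (Fin m) n)
allVecs m zero    = [ [] ]
allVecs m (suc n) = concatMap (λ i → List.map (i ∷_) (allVecs m n)) (allFin m)

-- Its active domain is represented as Fin dom
-- (every finite instance is isomorphic to one of this form); each relation
-- R^A is the finite set of tuples t with rel R t ≡ true.  The field `covers`
-- says every element of Fin dom occurs in some fact, so adom(A) = Fin dom.
record Instance (S : Schema) : Set where
  field
    dom    : ℕ
    rel    : (R : Fin (size S)) → Vec (Fin dom) (arity S R) → Bool
    covers : ∀ (a : Fin dom) →
             Σ (Fin (size S)) λ R → Σ (Vec (Fin dom) (arity S R)) λ t →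
               T (rel R t) × a ∈ t
open Instance public

module _ {S : Schema} where

  isHom : (A B : Instance S) → Vec (Fin (dom B)) (dom A) → Bool
  isHom A B h =
    all (λ R → all (λ t → not (rel A R t) ∨ rel B R (Vec.map (lookup h) t))
                   (allVecs (dom A) (arity S R)))
        (allFin (size S))

  _⟶_ : Instance S → Instance S → Set
  A ⟶ B = Σ (Vec (Fin (dom B)) (dom A)) λ h → T (isHom A B h)

  HomEquiv : Instance S → Instance S → Set
  HomEquiv A B = (A ⟶ B) × (B ⟶ A)

  homℕ : Instance S → Instance S → ℕ
  homℕ A B = length (filter (λ h → T? (isHom A B h)) (allVecs (dom B) (dom A)))
    where
      T? : (b : Bool) → Dec (T b)
      T? true  = yes _
      T? false = no (λ ())

  hom𝔹 : Instance S → Instance S → Bool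
  hom𝔹 A B = any (isHom A B) (allVecs (dom B) (dom A))

  homℕ-vec : ∀ {k} → Vec (Instance S) k → Instance S → Vec ℕ k
  homℕ-vec F D = Vec.map (λ Fi → homℕ Fi D) F

  hom𝔹-vec : ∀ {k} → Vec (Instance S) k → Instance S → Vec Bool k
  hom𝔹-vec F D = Vec.map (λ Fi → hom𝔹 Fi D) F

  Adjacent : (A : Instance S) → Fin (dom A) → Fin (dom A) → Set
  Adjacent A a b = Σ (Fin (size S)) λ R → Σ (Vec (Fin (dom A)) (arity S R)) λ t →
                     T (rel A R t) × a ∈ t × b ∈ t

  Connected : Instance S → Set
  Connected A = ∀ (a a' : Fin (dom A)) → Star (Adjacent A) a a'

  ClosedUnderHomEquiv : (Instance S → Set) → Set
  ClosedUnderHomEquiv C = ∀ A B → HomEquiv A B → C A → C B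

  LeftQueryℕ : (Instance S → Set) → ∀ {k} → Vec (Instance S) k → (Vec ℕ k → Set) → Set
  LeftQueryℕ C F X = ∀ D → C D ⇔ X (homℕ-vec F D)

  LeftQuery𝔹 : (Instance S → Set) → ∀ {k} → Vec (Instance S) k → (Vec Bool k → Set) → Set
  LeftQuery𝔹 C F X = ∀ D → C D ⇔ X (hom𝔹-vec F D)

-- The Boolean vector hom_𝔹(F, D) is the zero pattern of hom_ℕ(F, D), which
-- gives (2) ⇒ (1).  For (1) ⇒ (2) it suffices to show that membership in C only depends on
-- this zero pattern.  So let D₀ and D have the same pattern, with counts aᵢ = hom(Fᵢ, D₀) and
-- bᵢ = hom(Fᵢ, D), and let K be the product of the nonzero counts.  For a connected nonempty
-- Fᵢ, counting homomorphisms into an instance is additive on disjoint unions and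
-- multiplicative on products, so every polynomial with natural coefficients in D₀ or D is
-- realised by an instance built from D₀, D and the one-point loop 𝟙.  Choosing r = r⁺ − r⁻
-- with r(x) = K / x at every nonzero count, the instances
--   A = D₀ × (K·𝟙 + D × (r⁺(D₀) + r⁻(D)))   and   B = D × (K·𝟙 + D₀ × (r⁺(D) + r⁻(D₀)))
-- have equal counts aᵢ(K + bᵢ(r⁺(aᵢ) + r⁻(bᵢ))) = bᵢ(K + aᵢ(r⁺(bᵢ) + r⁻(aᵢ))), since their
-- difference is (aᵢ − bᵢ)K + aᵢbᵢ(K/aᵢ − K/bᵢ) = 0.  A projection and a map through the
-- one-point loop make A homomorphically equivalent to D₀, and B to D.  Hence
-- D₀ ∈ C ⇒ A ∈ C ⇒ B ∈ C ⇒ D ∈ C.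

module Submission where

open import Defs
open import Data.Bool using (Bool; true; false; not; _∨_; _∧_; T)
open import Data.Bool.ListAction using (all; any)
open import Data.Bool.Properties using (T?; T-∧; T-∨)
open import Data.Empty using (⊥-elim)
open import Data.Fin using (Fin; zero; suc; _↑ˡ_; _↑ʳ_; splitAt; remQuot; combine)
import Data.Fin as Fin
open import Data.Fin.Properties
  using (splitAt-↑ˡ; splitAt-↑ʳ; splitAt⁻¹-↑ˡ; splitAt⁻¹-↑ʳ; ↑ˡ-injective; ↑ʳ-injective;
         remQuot-combine; combine-remQuot)
open import Data.List using (List; []; _∷_; [_]; _++_; length; filter; allFin; cartesianProductWith)
import Data.List as List
import Data.List.Properties as List
open import Data.List.Membership.Propositional using (_∈_; lose; find)
open import Data.List.Membership.Propositional.Properties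
  using (∈-allFin; ∈-lookup; ∈-filter⁺; ∈-filter⁻; ∈-map⁺; ∈-map⁻; ∈-++⁺ˡ; ∈-++⁺ʳ; ∈-++⁻;
         ∈-cartesianProductWith⁺; ∈-cartesianProduct⁺; ∈-cartesianProduct⁻)
open import Data.List.Membership.Propositional.Properties.WithK using (unique∧set⇒bag)
open import Data.List.Relation.Binary.BagAndSetEquality using (∼bag⇒↭)
open import Data.List.Relation.Binary.Permutation.Propositional.Properties using (↭-length)
import Data.List.Relation.Unary.All as All
open import Data.List.Relation.Unary.All.Properties using (all⁺; all⁻)
open import Data.List.Relation.Unary.AllPairs using ([]; _∷_)
import Data.List.Relation.Unary.Any as Any
open import Data.List.Relation.Unary.Any using (here; there)
open import Data.List.Relation.Unary.Any.Properties using (any⁺; any⁻; lookup-index)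
open import Data.List.Relation.Unary.Unique.Propositional using (Unique)
import Data.List.Relation.Unary.Unique.Propositional.Properties as Unique
open import Data.Nat using (ℕ; zero; suc; _+_; _*_; _<ᵇ_; _≤_; s≤s)
open import Data.Nat.Tactic.RingSolver using (solve-∀)
open import Data.Product using (Σ; ∃; _×_; _,_; proj₁; proj₂; swap)
open import Data.Sum using (_⊎_; inj₁; inj₂; [_,_]′)
import Data.Sum as Sum
open import Data.Vec using (Vec; []; _∷_; lookup; tabulate)
import Data.Vec as Vec
import Data.Vec.Properties as Vec
open import Data.Vec.Membership.Propositional using () renaming (_∈_ to _∈ᵥ_)
open import Data.Vec.Membership.Propositional.Properties
  renaming (∈-map⁺ to ∈ᵥ-map⁺; ∈-lookup to ∈ᵥ-lookup) using ()
open import Data.Vec.Relation.Unary.Any using (here; there)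
open import Function using (_∘_; id)
open import Function.Bundles using (_⇔_; mk⇔; Equivalence)
import Relation.Binary.Construct.Closure.ReflexiveTransitive as Star
open import Relation.Binary.PropositionalEquality
  using (_≡_; _≢_; refl; sym; trans; cong; cong₂; subst; module ≡-Reasoning)
open import Relation.Nullary using (¬_)
open import Relation.Nullary.Decidable using (isYes; toWitness; fromWitness)

T-implies : ∀ a {b} → T (not a ∨ b) ⇔ (T a → T b)
T-implies true  = mk⇔ (λ p _ → p) (λ f → f _)
T-implies false = mk⇔ (λ _ ()) (λ _ → _)

any≡0<ᵇlength-filter : ∀ {A : Set} (p : A → Bool) xs → any p xs ≡ (0 <ᵇ length (filter (T? ∘ p) xs))
any≡0<ᵇlength-filter p []       = refl
any≡0<ᵇlength-filter p (x ∷ xs) with p x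
... | true  = refl
... | false = any≡0<ᵇlength-filter p xs

inhabited-or-zero : ∀ n → Fin n ⊎ n ≡ 0
inhabited-or-zero zero    = inj₂ refl
inhabited-or-zero (suc n) = inj₁ zero

lookup-injective : ∀ {A : Set} {xs : List A} → Unique xs →
                   ∀ i j → List.lookup xs i ≡ List.lookup xs j → i ≡ j
lookup-injective (_    ∷ _)   zero    zero    _ = refl
lookup-injective (x∉xs ∷ _)   zero    (suc j) e = ⊥-elim (All.lookup x∉xs (∈-lookup j) e)
lookup-injective (x∉xs ∷ _)   (suc i) zero    e = ⊥-elim (All.lookup x∉xs (∈-lookup i) (sym e))
lookup-injective (_    ∷ xs!) (suc i) (suc j) e = cong suc (lookup-injective xs! i j e)

length-≡ : ∀ {A : Set} {xs ys : List A} → Unique xs → Unique ys →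
           (∀ {z} → z ∈ xs ⇔ z ∈ ys) → length xs ≡ length ys
length-≡ xs! ys! xs≈ys = ↭-length (∼bag⇒↭ (unique∧set⇒bag xs! ys! xs≈ys))

length-cartesianProduct : ∀ {A B : Set} (xs : List A) (ys : List B) →
                          length (List.cartesianProduct xs ys) ≡ length xs * length ys
length-cartesianProduct []       ys = refl
length-cartesianProduct (x ∷ xs) ys = begin
  length (List.map (x ,_) ys ++ List.cartesianProduct xs ys)
    ≡⟨ List.length-++ (List.map (x ,_) ys) ⟩
  length (List.map (x ,_) ys) + length (List.cartesianProduct xs ys)
    ≡⟨ cong₂ _+_ (List.length-map (x ,_) ys) (length-cartesianProduct xs ys) ⟩
  length ys + length xs * length ys ∎
  where open ≡-Reasoning

allVecs-suc : ∀ m n → allVecs m (suc n) ≡ cartesianProductWith _∷_ (allFin m) (allVecs m n)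
allVecs-suc m n = go (allFin m)
  where
  go : ∀ is → List.concatMap (λ i → List.map (i ∷_) (allVecs m n)) is
              ≡ cartesianProductWith _∷_ is (allVecs m n)
  go []       = refl
  go (i ∷ is) = cong (List.map (i ∷_) (allVecs m n) ++_) (go is)

∈-allVecs : ∀ {m n} (v : Vec (Fin m) n) → v ∈ allVecs m n
∈-allVecs             []      = here refl
∈-allVecs {m} {suc n} (i ∷ v) rewrite allVecs-suc m n =
  ∈-cartesianProductWith⁺ _∷_ (∈-allFin i) (∈-allVecs v)

allVecs-unique : ∀ m n → Unique (allVecs m n)
allVecs-unique m zero    = All.[] ∷ []
allVecs-unique m (suc n) rewrite allVecs-suc m n =
  Unique.cartesianProductWith⁺ _∷_ Vec.∷-injective (Unique.allFin⁺ m) (allVecs-unique m n)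

∈ᵥ-map⁻ : ∀ {A B : Set} (f : A → B) {n y} {xs : Vec A n} →
          y ∈ᵥ Vec.map f xs → ∃ λ x → x ∈ᵥ xs × y ≡ f x
∈ᵥ-map⁻ f {xs = x ∷ xs} (here refl) = x , here refl , refl
∈ᵥ-map⁻ f {xs = x ∷ xs} (there y∈) = let z , z∈ , e = ∈ᵥ-map⁻ f y∈ in z , there z∈ , e

map-injective : ∀ {A B : Set} {f : A → B} → (∀ {x y} → f x ≡ f y → x ≡ y) →
                ∀ {n} {xs ys : Vec A n} → Vec.map f xs ≡ Vec.map f ys → xs ≡ ys
map-injective f-inj {xs = []}     {[]}     _ = refl
map-injective f-inj {xs = x ∷ xs} {y ∷ ys} e =
  let e₁ , e₂ = Vec.∷-injective e in cong₂ _∷_ (f-inj e₁) (map-injective f-inj e₂)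

map₂-injective : ∀ {A B C : Set} {f : A → B} {g : A → C} → (∀ {x y} → f x ≡ f y → g x ≡ g y → x ≡ y) →
                 ∀ {n} {xs ys : Vec A n} → Vec.map f xs ≡ Vec.map f ys → Vec.map g xs ≡ Vec.map g ys → xs ≡ ys
map₂-injective fg-inj {xs = []}     {[]}     _ _  = refl
map₂-injective fg-inj {xs = x ∷ xs} {y ∷ ys} e e′ =
  let e₁ , e₂ = Vec.∷-injective e ; e₁′ , e₂′ = Vec.∷-injective e′
  in cong₂ _∷_ (fg-inj e₁ e₁′) (map₂-injective fg-inj e₂ e₂′)

map-factor : ∀ {A B C : Set} {n} {ι : B → C} {g : A → B} {f : A → C} →
             (∀ x → ι (g x) ≡ f x) → (t : Vec A n) → Vec.map ι (Vec.map g t) ≡ Vec.map f t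
map-factor {ι = ι} {g} ι∘g≗f t = trans (sym (Vec.map-∘ ι g t)) (Vec.map-cong ι∘g≗f t)

tabulate-factor : ∀ {A B : Set} {n} (ι : A → B) (h : Vec B n) (g : Fin n → A) →
                  (∀ x → ι (g x) ≡ lookup h x) → h ≡ Vec.map ι (tabulate g)
tabulate-factor ι h g ι∘g≗h = begin
  h                        ≡⟨ Vec.tabulate∘lookup h ⟨
  tabulate (lookup h)      ≡⟨ Vec.tabulate-cong (sym ∘ ι∘g≗h) ⟩
  tabulate (ι ∘ g)         ≡⟨ Vec.tabulate-∘ ι g ⟩
  Vec.map ι (tabulate g)   ∎
  where open ≡-Reasoning

map-cong-lookup : ∀ {A B : Set} {f g : A → B} {n} (xs : Vec A n) →
                  (∀ i → f (lookup xs i) ≡ g (lookup xs i)) → Vec.map f xs ≡ Vec.map g xs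
map-cong-lookup []       _   = refl
map-cong-lookup (x ∷ xs) f≗g = cong₂ _∷_ (f≗g zero) (map-cong-lookup xs (f≗g ∘ suc))

lookup-map-≡ : ∀ {A B : Set} {f g : A → B} {n} {xs : Vec A n} →
               Vec.map f xs ≡ Vec.map g xs → ∀ i → f (lookup xs i) ≡ g (lookup xs i)
lookup-map-≡ {f = f} {g} {xs = xs} e i =
  trans (sym (Vec.lookup-map i f xs)) (trans (cong (λ v → lookup v i) e) (Vec.lookup-map i g xs))

-- Polynomials and the reciprocal interpolant

infixl 6 _:+_
infixl 7 _:*_

data Poly : Set where
  one var   : Poly
  _:+_ _:*_ : Poly → Poly → Poly

eval : Poly → ℕ → ℕ
eval one      x = 1
eval var      x = x
eval (p :+ q) x = eval p x + eval q x
eval (p :* q) x = eval p x * eval q x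

lit : ℕ → Poly
lit zero    = one
lit (suc n) = one :+ lit n

eval-lit : ∀ n x → eval (lit n) x ≡ suc n
eval-lit zero    x = refl
eval-lit (suc n) x = cong suc (eval-lit n x)

-- suc (κ U) is the product K of the nonzero entries v of U, and recip⁺ U − recip⁻ U is the
-- integer polynomial (K − ∏ (v − x)) / x, which takes the value K / v at every such v.

κ : List ℕ → ℕ
κ []          = 0
κ (zero  ∷ U) = κ U
κ (suc u ∷ U) = κ U + u * suc (κ U)

recip⁺ recip⁻ : List ℕ → Poly
recip⁺ []          = one
recip⁺ (zero  ∷ U) = recip⁺ U
recip⁺ (suc u ∷ U) = lit (κ U) :+ (lit u :* recip⁺ U :+ var :* recip⁻ U)
recip⁻ []          = one
recip⁻ (zero  ∷ U) = recip⁻ U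
recip⁻ (suc u ∷ U) = lit u :* recip⁻ U :+ var :* recip⁺ U

recip-step-new : ∀ v K P M → v * (K + (v * P + v * M)) ≡ v * K + v * (v * M + v * P)
recip-step-new = solve-∀

recip-step-old : ∀ x v K P M → x * P ≡ K + x * M → x * (K + (v * P + x * M)) ≡ v * K + x * (v * M + x * P)
recip-step-old x v K P M xP≡ = begin
  x * (K + (v * P + x * M))              ≡⟨ expand x v K P M ⟩
  x * K + v * (x * P) + x * x * M        ≡⟨ cong (λ z → x * K + v * z + x * x * M) xP≡ ⟩
  x * K + v * (K + x * M) + x * x * M    ≡⟨ regroup x v K M ⟩
  v * K + x * (v * M) + x * (K + x * M)  ≡⟨ cong (λ z → v * K + x * (v * M) + x * z) xP≡ ⟨
  v * K + x * (v * M) + x * (x * P)      ≡⟨ collect x v K P M ⟩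
  v * K + x * (v * M + x * P)            ∎
  where
  open ≡-Reasoning
  expand : ∀ x v K P M → x * (K + (v * P + x * M)) ≡ x * K + v * (x * P) + x * x * M
  expand = solve-∀
  regroup : ∀ x v K M → x * K + v * (K + x * M) + x * x * M ≡ v * K + x * (v * M) + x * (K + x * M)
  regroup = solve-∀
  collect : ∀ x v K P M → v * K + x * (v * M) + x * (x * P) ≡ v * K + x * (v * M + x * P)
  collect = solve-∀

recip-spec : ∀ U {u} → suc u ∈ U →
             suc u * eval (recip⁺ U) (suc u) ≡ suc (κ U) + suc u * eval (recip⁻ U) (suc u)
recip-spec (zero  ∷ U) (there u∈U) = recip-spec U u∈U
recip-spec (suc w ∷ U) {u} u∈ rewrite eval-lit (κ U) (suc u) | eval-lit w (suc u) with u∈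
... | here refl  = recip-step-new (suc w) (suc (κ U)) (eval (recip⁺ U) (suc w)) (eval (recip⁻ U) (suc w))
... | there u∈U  = recip-step-old (suc u) (suc w) (suc (κ U)) (eval (recip⁺ U) (suc u))
                                  (eval (recip⁻ U) (suc u)) (recip-spec U u∈U)

cross-balance : ∀ K a b Pa Ma Pb Mb → a * Pa ≡ K + a * Ma → b * Pb ≡ K + b * Mb →
                a * (K + b * (Pa + Mb)) ≡ b * (K + a * (Pb + Ma))
cross-balance K a b Pa Ma Pb Mb aPa≡ bPb≡ = begin
  a * (K + b * (Pa + Mb))                ≡⟨ expand a b K Pa Mb ⟩
  a * K + b * (a * Pa) + a * b * Mb      ≡⟨ cong (λ z → a * K + b * z + a * b * Mb) aPa≡ ⟩
  a * K + b * (K + a * Ma) + a * b * Mb  ≡⟨ exchange a b K Ma Mb ⟩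
  b * K + a * (K + b * Mb) + b * a * Ma  ≡⟨ cong (λ z → b * K + a * z + b * a * Ma) bPb≡ ⟨
  b * K + a * (b * Pb) + b * a * Ma      ≡⟨ expand b a K Pb Ma ⟨
  b * (K + a * (Pb + Ma))                ∎
  where
  open ≡-Reasoning
  expand : ∀ a b K P M → a * (K + b * (P + M)) ≡ a * K + b * (a * P) + a * b * M
  expand = solve-∀
  exchange : ∀ a b K Ma Mb → a * K + b * (K + a * Ma) + a * b * Mb ≡ b * K + a * (K + b * Mb) + b * a * Ma
  exchange = solve-∀

weight : List ℕ → ℕ → ℕ → ℕ
weight U x y = suc (κ U) + y * (eval (recip⁺ U) x + eval (recip⁻ U) y)

weight-balanced : ∀ U {a b} → a ∈ U → b ∈ U → (0 <ᵇ a) ≡ (0 <ᵇ b) → a * weight U a b ≡ b * weight U b a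
weight-balanced U {zero}  {zero}  _   _   _  = refl
weight-balanced U {zero}  {suc b} _   _   ()
weight-balanced U {suc a} {zero}  _   _   ()
weight-balanced U {suc a} {suc b} a∈U b∈U _  =
  cross-balance (suc (κ U)) (suc a) (suc b) _ _ _ _ (recip-spec U a∈U) (recip-spec U b∈U)

module _ {S : Schema} where

  record Hom (A B : Instance S) (f : Fin (dom A) → Fin (dom B)) : Set where
    constructor hom
    field preserves : ∀ R t → T (rel A R t) → T (rel B R (Vec.map f t))
  open Hom public

  Hom-id : ∀ {A} → Hom A A id
  Hom-id {A} = hom λ R t r → subst (T ∘ rel A R) (sym (Vec.map-id t)) r

  Hom-∘ : ∀ {A B C} {f g} → Hom A B f → Hom B C g → Hom A C (g ∘ f)
  Hom-∘ {C = C} {f = f} {g} f-hom g-hom = hom λ R t r →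
    subst (T ∘ rel C R) (sym (Vec.map-∘ g f t)) (preserves g-hom R _ (preserves f-hom R t r))

  Hom-cong : ∀ {A B} {f g} → (∀ x → f x ≡ g x) → Hom A B f → Hom A B g
  Hom-cong {B = B} f≗g f-hom = hom λ R t r →
    subst (T ∘ rel B R) (Vec.map-cong f≗g t) (preserves f-hom R t r)

  Hom-factor : ∀ {F A M : Instance S} {ι : Fin (dom A) → Fin (dom M)} {f} →
               (∀ {R u} → T (rel M R (Vec.map ι u)) → T (rel A R u)) → Hom F M f →
               (pre : ∀ x → ∃ λ z → ι z ≡ f x) → Hom F A (proj₁ ∘ pre)
  Hom-factor {M = M} reflects f-hom pre = hom λ R t r →
    reflects (subst (T ∘ rel M R) (sym (map-factor (proj₂ ∘ pre) t)) (preserves f-hom R t r))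

  isHom⇔Hom : ∀ A B h → T (isHom A B h) ⇔ Hom A B (lookup h)
  isHom⇔Hom A B h = mk⇔ to from
    where
    preserved : ∀ R → Vec (Fin (dom A)) (arity S R) → Bool
    preserved R t = not (rel A R t) ∨ rel B R (Vec.map (lookup h) t)
    preservedAll : Fin (size S) → Bool
    preservedAll R = all (preserved R) (allVecs (dom A) (arity S R))
    to : T (isHom A B h) → Hom A B (lookup h)
    to p = hom λ R t → Equivalence.to (T-implies (rel A R t))
      (All.lookup (all⁺ (preserved R) _ (All.lookup (all⁺ preservedAll _ p) (∈-allFin R))) (∈-allVecs t))
    from : Hom A B (lookup h) → T (isHom A B h)
    from f = all⁻ preservedAll {xs = allFin _} (All.tabulate λ {R} _ →
               all⁻ (preserved R) {xs = allVecs _ _} (All.tabulate λ {t} _ →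
                 Equivalence.from (T-implies (rel A R t)) (preserves f R t)))

  toHom : ∀ {A B} {f} → Hom A B f → A ⟶ B
  toHom {A} {B} {f} f-hom =
    tabulate f , Equivalence.from (isHom⇔Hom A B (tabulate f)) (Hom-cong (sym ∘ Vec.lookup∘tabulate f) f-hom)

  HomEquiv-refl : ∀ {A : Instance S} → HomEquiv A A
  HomEquiv-refl {A} = toHom (Hom-id {A = A}) , toHom (Hom-id {A = A})

  homs : (A B : Instance S) → List (Vec (Fin (dom B)) (dom A))
  homs A B = filter (T? ∘ isHom A B) (allVecs (dom B) (dom A))

  homℕ≡length-homs : ∀ A B → homℕ A B ≡ length (homs A B)
  homℕ≡length-homs A B = cong length (List.filter-≐ _ (T? ∘ isHom A B) (id , id) (allVecs (dom B) (dom A)))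

  homs-unique : ∀ A B → Unique (homs A B)
  homs-unique A B = Unique.filter⁺ (T? ∘ isHom A B) (allVecs-unique (dom B) (dom A))

  ∈-homs : ∀ A B {h} → h ∈ homs A B ⇔ Hom A B (lookup h)
  ∈-homs A B {h} = mk⇔
    (λ h∈ → Equivalence.to (isHom⇔Hom A B h) (proj₂ (∈-filter⁻ (T? ∘ isHom A B) {xs = allVecs _ _} h∈)))
    (λ h-hom → ∈-filter⁺ (T? ∘ isHom A B) (∈-allVecs h) (Equivalence.from (isHom⇔Hom A B h) h-hom))

  ∈-homs-map : ∀ {F A M : Instance S} {ι} → Hom A M ι → ∀ {w} → w ∈ homs F A → Vec.map ι w ∈ homs F M
  ∈-homs-map {F} {A} {M} {ι} ι-hom {w} w∈ = Equivalence.from (∈-homs F M)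
    (Hom-cong (λ x → sym (Vec.lookup-map x ι w)) (Hom-∘ (Equivalence.to (∈-homs F A) w∈) ι-hom))

  ∈-homs-factor : ∀ {F A M : Instance S} {ι : Fin (dom A) → Fin (dom M)} →
                  (∀ {R u} → T (rel M R (Vec.map ι u)) → T (rel A R u)) →
                  ∀ {h} → h ∈ homs F M → (∀ x → ∃ λ z → ι z ≡ lookup h x) →
                  ∃ λ w → w ∈ homs F A × h ≡ Vec.map ι w
  ∈-homs-factor {F} {A} {M} {ι} reflects {h} h∈ pre =
    tabulate (proj₁ ∘ pre) ,
    Equivalence.from (∈-homs F A) (Hom-cong (sym ∘ Vec.lookup∘tabulate _) (Hom-factor reflects h-hom pre)) ,
    tabulate-factor ι h (proj₁ ∘ pre) (proj₂ ∘ pre)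
    where h-hom = Equivalence.to (∈-homs F M) h∈

  hom𝔹≡0<ᵇhomℕ : ∀ (A B : Instance S) → hom𝔹 A B ≡ (0 <ᵇ homℕ A B)
  hom𝔹≡0<ᵇhomℕ A B = trans (any≡0<ᵇlength-filter (isHom A B) (allVecs (dom B) (dom A)))
                             (cong (0 <ᵇ_) (sym (homℕ≡length-homs A B)))

  hom𝔹-vec≡ : ∀ {k} (F : Vec (Instance S) k) D → hom𝔹-vec F D ≡ Vec.map (0 <ᵇ_) (homℕ-vec F D)
  hom𝔹-vec≡ F D = trans (Vec.map-cong (λ Fᵢ → hom𝔹≡0<ᵇhomℕ Fᵢ D) F) (Vec.map-∘ (0 <ᵇ_) (λ Fᵢ → homℕ Fᵢ D) F)

  homℕ-unique : ∀ {A B : Instance S} (h₀ : Vec (Fin (dom B)) (dom A)) → Hom A B (lookup h₀) →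
                (∀ h → h ≡ h₀) → homℕ A B ≡ 1
  homℕ-unique {A} {B} h₀ h₀-hom ≡h₀ =
    trans (homℕ≡length-homs A B) (length-≡ (homs-unique A B) (All.[] ∷ []) (mk⇔ to from))
    where
    to : ∀ {h} → h ∈ homs A B → h ∈ [ h₀ ]
    to {h} _ = here (≡h₀ h)
    from : ∀ {h} → h ∈ [ h₀ ] → h ∈ homs A B
    from (here refl) = Equivalence.from (∈-homs A B) h₀-hom

  empty-tuple : ∀ {k} → 1 ≤ k → ¬ Vec (Fin 0) k
  empty-tuple (s≤s _) (() ∷ _)

  homℕ-from-empty : ∀ {F : Instance S} B → dom F ≡ 0 → homℕ F B ≡ 1
  homℕ-from-empty {F} B dom≡0 =
    homℕ-unique {A = F} {B} h₀ (hom λ R t _ → ⊥-elim (no-tuple R t)) (all-equal dom≡0 h₀)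
    where
    h₀ : Vec (Fin (dom B)) (dom F)
    h₀ = subst (Vec _) (sym dom≡0) []
    no-tuple : ∀ R → ¬ Vec (Fin (dom F)) (arity S R)
    no-tuple R t = empty-tuple (arity-pos S R) (subst (λ m → Vec (Fin m) _) dom≡0 t)
    all-equal : ∀ {X : Set} {n} → n ≡ 0 → (v u : Vec X n) → u ≡ v
    all-equal refl [] [] = refl

  empty-schema : size S ≡ 0 → ∀ (A : Instance S) → dom A ≡ 0
  empty-schema size≡0 A =
    [ (λ a → ⊥-elim (no-relation (proj₁ (covers A a)))) , id ]′ (inhabited-or-zero (dom A))
    where
    no-relation : ¬ Fin (size S)
    no-relation R with () ← subst Fin size≡0 R

-- Disjoint union

  image : ∀ (A : Instance S) {m} → (Fin (dom A) → Fin m) → ∀ R → Vec (Fin m) (arity S R) → Bool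
  image A f R t =
    any (λ u → rel A R u ∧ isYes (Vec.≡-dec Fin._≟_ (Vec.map f u) t)) (allVecs (dom A) (arity S R))

  image-complete : ∀ A {m} (f : Fin (dom A) → Fin m) {R u} → T (rel A R u) → T (image A f R (Vec.map f u))
  image-complete A f {u = u} r = any⁺ _ (lose (∈-allVecs u) (Equivalence.from T-∧ (r , fromWitness refl)))

  image-sound : ∀ A {m} (f : Fin (dom A) → Fin m) {R t} → T (image A f R t) →
                ∃ λ u → T (rel A R u) × Vec.map f u ≡ t
  image-sound A f {R} p =
    let u , _ , q = find (any⁻ _ (allVecs (dom A) (arity S R)) p)
        r , e     = Equivalence.to T-∧ q
    in u , r , toWitness e

  infixr 6 _⊕_
  _⊕_ : Instance S → Instance S → Instance S
  A ⊕ B = record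
    { dom    = dom A + dom B
    ; rel    = λ R t → image A (_↑ˡ dom B) R t ∨ image B (dom A ↑ʳ_) R t
    ; covers = covers-⊕
    }
    where
    covers-⊕ : ∀ y → Σ (Fin (size S)) λ R → Σ (Vec (Fin (dom A + dom B)) (arity S R)) λ t →
               T (image A (_↑ˡ dom B) R t ∨ image B (dom A ↑ʳ_) R t) × y ∈ᵥ t
    covers-⊕ y with splitAt (dom A) y in e
    ... | inj₁ x = let R , t , r , x∈t = covers A x in
      R , Vec.map (_↑ˡ dom B) t , Equivalence.from T-∨ (inj₁ (image-complete A _ r)) ,
      subst (_∈ᵥ _) (splitAt⁻¹-↑ˡ e) (∈ᵥ-map⁺ _ x∈t)
    ... | inj₂ x = let R , t , r , x∈t = covers B x in
      R , Vec.map (dom A ↑ʳ_) t , Equivalence.from T-∨ (inj₂ (image-complete B _ r)) ,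
      subst (_∈ᵥ _) (splitAt⁻¹-↑ʳ e) (∈ᵥ-map⁺ _ x∈t)

  module Coproduct (A B : Instance S) where

    inl : Fin (dom A) → Fin (dom (A ⊕ B))
    inl = _↑ˡ dom B

    inr : Fin (dom B) → Fin (dom (A ⊕ B))
    inr = dom A ↑ʳ_

    inl-hom : Hom A (A ⊕ B) inl
    inl-hom = hom λ R t r → Equivalence.from T-∨ (inj₁ (image-complete A inl r))

    inr-hom : Hom B (A ⊕ B) inr
    inr-hom = hom λ R t r → Equivalence.from T-∨ (inj₂ (image-complete B inr r))

    ⊕-fact : ∀ {R t} → T (rel (A ⊕ B) R t) →
             (∃ λ u → T (rel A R u) × Vec.map inl u ≡ t) ⊎ (∃ λ u → T (rel B R u) × Vec.map inr u ≡ t)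
    ⊕-fact = Sum.map (image-sound A inl) (image-sound B inr) ∘ Equivalence.to T-∨

    isLeft : Fin (dom (A ⊕ B)) → Bool
    isLeft y = [ (λ _ → true) , (λ _ → false) ]′ (splitAt (dom A) y)

    isLeft-inl : ∀ x → isLeft (inl x) ≡ true
    isLeft-inl x rewrite splitAt-↑ˡ (dom A) x (dom B) = refl

    isLeft-inr : ∀ x → isLeft (inr x) ≡ false
    isLeft-inr x rewrite splitAt-↑ʳ (dom A) (dom B) x = refl

    left-preimage : ∀ y → isLeft y ≡ true → ∃ λ x → inl x ≡ y
    left-preimage y _ with splitAt (dom A) y in e
    ... | inj₁ x = x , splitAt⁻¹-↑ˡ e

    right-preimage : ∀ y → isLeft y ≡ false → ∃ λ x → inr x ≡ y
    right-preimage y _ with splitAt (dom A) y in e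
    ... | inj₂ x = x , splitAt⁻¹-↑ʳ e

    inl≢inr : ∀ x y → inl x ≢ inr y
    inl≢inr x y e with () ← trans (sym (isLeft-inl x)) (trans (cong isLeft e) (isLeft-inr y))

    map-inl≢map-inr : ∀ {k} → 1 ≤ k → (u : Vec (Fin (dom A)) k) (v : Vec (Fin (dom B)) k) →
                      Vec.map inl u ≢ Vec.map inr v
    map-inl≢map-inr (s≤s _) (x ∷ _) (y ∷ _) e = inl≢inr x y (Vec.∷-injectiveˡ e)

    inl-reflects : ∀ {R u} → T (rel (A ⊕ B) R (Vec.map inl u)) → T (rel A R u)
    inl-reflects {R} r with ⊕-fact r
    ... | inj₁ (_ , r′ , e) = subst (T ∘ rel A R) (map-injective (↑ˡ-injective _ _ _) e) r′
    ... | inj₂ (v , _ , e)  = ⊥-elim (map-inl≢map-inr (arity-pos S R) _ v (sym e))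

    inr-reflects : ∀ {R u} → T (rel (A ⊕ B) R (Vec.map inr u)) → T (rel B R u)
    inr-reflects {R} r with ⊕-fact r
    ... | inj₁ (u , _ , e)  = ⊥-elim (map-inl≢map-inr (arity-pos S R) u _ e)
    ... | inj₂ (_ , r′ , e) = subst (T ∘ rel B R) (map-injective (↑ʳ-injective _ _ _) e) r′

    isLeft-image : ∀ {C : Set} (ι : C → Fin (dom (A ⊕ B))) {b} → (∀ x → isLeft (ι x) ≡ b) →
                   ∀ {k} {w : Vec C k} {y} → y ∈ᵥ Vec.map ι w → isLeft y ≡ b
    isLeft-image ι side y∈ = let x , _ , e = ∈ᵥ-map⁻ ι y∈ in subst (λ y → isLeft y ≡ _) (sym e) (side x)

    isLeft-fact : ∀ {R t y z} → T (rel (A ⊕ B) R t) → y ∈ᵥ t → z ∈ᵥ t → isLeft y ≡ isLeft z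
    isLeft-fact r y∈ z∈ with ⊕-fact r
    ... | inj₁ (_ , _ , refl) = trans (isLeft-image inl isLeft-inl y∈) (sym (isLeft-image inl isLeft-inl z∈))
    ... | inj₂ (_ , _ , refl) = trans (isLeft-image inr isLeft-inr y∈) (sym (isLeft-image inr isLeft-inr z∈))

    -- A connected instance may be empty, and then it has one homomorphism into A, B and A ⊕ B
    -- alike; the element x₀ excludes this case.
    module _ (F : Instance S) (F-connected : Connected F) (x₀ : Fin (dom F)) where

      isLeft-constant : ∀ {f} → Hom F (A ⊕ B) f → ∀ x → isLeft (f x) ≡ isLeft (f x₀)
      isLeft-constant {f} f-hom x =
        Star.fold (λ a b → isLeft (f a) ≡ isLeft (f b)) step refl (F-connected x x₀)
        where
        step : ∀ {a b c} → Adjacent F a b → isLeft (f b) ≡ isLeft (f c) → isLeft (f a) ≡ isLeft (f c)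
        step (R , t , r , a∈t , b∈t) =
          trans (isLeft-fact (preserves f-hom R t r) (∈ᵥ-map⁺ f a∈t) (∈ᵥ-map⁺ f b∈t))

      sumHoms : List (Vec (Fin (dom (A ⊕ B))) (dom F))
      sumHoms = List.map (Vec.map inl) (homs F A) ++ List.map (Vec.map inr) (homs F B)

      homs-⊕⇒ : ∀ {h} → h ∈ homs F (A ⊕ B) → h ∈ sumHoms
      homs-⊕⇒ {h} h∈ = onSide (isLeft (lookup h x₀)) refl
        where
        same : ∀ x → isLeft (lookup h x) ≡ isLeft (lookup h x₀)
        same = isLeft-constant (Equivalence.to (∈-homs F (A ⊕ B)) h∈)
        onSide : ∀ b → isLeft (lookup h x₀) ≡ b → h ∈ sumHoms
        onSide true e =
          let w , w∈ , h≡ = ∈-homs-factor {F = F} {A} {A ⊕ B} {inl} inl-reflects h∈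
                              (λ x → left-preimage _ (trans (same x) e))
          in subst (_∈ sumHoms) (sym h≡) (∈-++⁺ˡ (∈-map⁺ (Vec.map inl) w∈))
        onSide false e =
          let w , w∈ , h≡ = ∈-homs-factor {F = F} {B} {A ⊕ B} {inr} inr-reflects h∈
                              (λ x → right-preimage _ (trans (same x) e))
          in subst (_∈ sumHoms) (sym h≡) (∈-++⁺ʳ _ (∈-map⁺ (Vec.map inr) w∈))

      homs-⊕⇐ : ∀ {h} → h ∈ sumHoms → h ∈ homs F (A ⊕ B)
      homs-⊕⇐ h∈ with ∈-++⁻ (List.map (Vec.map inl) (homs F A)) h∈
      ... | inj₁ h∈ˡ with _ , w∈ , refl ← ∈-map⁻ (Vec.map inl) h∈ˡ = ∈-homs-map {F = F} inl-hom w∈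
      ... | inj₂ h∈ʳ with _ , w∈ , refl ← ∈-map⁻ (Vec.map inr) h∈ʳ = ∈-homs-map {F = F} inr-hom w∈

      sumHoms-unique : Unique sumHoms
      sumHoms-unique = Unique.++⁺
        (Unique.map⁺ (map-injective (↑ˡ-injective _ _ _)) (homs-unique F A))
        (Unique.map⁺ (map-injective (↑ʳ-injective _ _ _)) (homs-unique F B))
        disjoint
        where
        disjoint : ∀ {h} → ¬ (h ∈ List.map (Vec.map inl) (homs F A) × h ∈ List.map (Vec.map inr) (homs F B))
        disjoint (h∈ˡ , h∈ʳ) with ∈-map⁻ (Vec.map inl) h∈ˡ | ∈-map⁻ (Vec.map inr) h∈ʳ
        ... | w , _ , refl | w′ , _ , e = inl≢inr _ _ (begin
          inl (lookup w x₀)           ≡⟨ Vec.lookup-map x₀ inl w ⟨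
          lookup (Vec.map inl w) x₀   ≡⟨ cong (λ v → lookup v x₀) e ⟩
          lookup (Vec.map inr w′) x₀  ≡⟨ Vec.lookup-map x₀ inr w′ ⟩
          inr (lookup w′ x₀)          ∎)
          where open ≡-Reasoning

      homℕ-⊕ : homℕ F (A ⊕ B) ≡ homℕ F A + homℕ F B
      homℕ-⊕ = begin
        homℕ F (A ⊕ B)                     ≡⟨ homℕ≡length-homs F (A ⊕ B) ⟩
        length (homs F (A ⊕ B))            ≡⟨ length-≡ (homs-unique F (A ⊕ B)) sumHoms-unique
                                                        (mk⇔ homs-⊕⇒ homs-⊕⇐) ⟩
        length sumHoms                     ≡⟨ List.length-++ (List.map (Vec.map inl) (homs F A)) ⟩
        length (List.map (Vec.map inl) (homs F A)) + length (List.map (Vec.map inr) (homs F B))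
                                           ≡⟨ cong₂ _+_ (List.length-map _ (homs F A))
                                                        (List.length-map _ (homs F B)) ⟩
        length (homs F A) + length (homs F B)
                                           ≡⟨ cong₂ _+_ (homℕ≡length-homs F A) (homℕ≡length-homs F B) ⟨
        homℕ F A + homℕ F B                ∎
        where open ≡-Reasoning

-- Direct product

  -- An Instance must have every element in some fact, so a structure on Fin n that may leave
  -- elements unused is replaced by its active part: the occurring elements, listed in order.
  module ActivePart (n : ℕ) (holds : ∀ R → Vec (Fin n) (arity S R) → Bool) where

    open import Data.Vec.Membership.DecPropositional (Fin._≟_ {n}) using (_∈?_)

    occurs : Fin n → Bool
    occurs z = any (λ R → any (λ t → holds R t ∧ isYes (z ∈? t)) (allVecs n (arity S R))) (allFin (size S))

    occurs-complete : ∀ {R t z} → T (holds R t) → z ∈ᵥ t → T (occurs z)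
    occurs-complete {R} {t} h z∈ =
      any⁺ _ (lose (∈-allFin R) (any⁺ _ (lose (∈-allVecs t) (Equivalence.from T-∧ (h , fromWitness z∈)))))

    occurs-sound : ∀ {z} → T (occurs z) → ∃ λ R → ∃ λ t → T (holds R t) × z ∈ᵥ t
    occurs-sound o =
      let R , _ , p = find (any⁻ _ (allFin (size S)) o)
          t , _ , q = find (any⁻ _ (allVecs n (arity S R)) p)
          h , z∈    = Equivalence.to T-∧ q
      in R , t , h , toWitness z∈

    occurring : List (Fin n)
    occurring = filter (T? ∘ occurs) (allFin n)

    emb : Fin (length occurring) → Fin n
    emb = List.lookup occurring

    emb-injective : ∀ {y z} → emb y ≡ emb z → y ≡ z
    emb-injective = lookup-injective (Unique.filter⁺ (T? ∘ occurs) (Unique.allFin⁺ n)) _ _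

    emb-occurs : ∀ y → T (occurs (emb y))
    emb-occurs y = proj₂ (∈-filter⁻ (T? ∘ occurs) {xs = allFin n} (∈-lookup y))

    emb-preimage : ∀ {z} → T (occurs z) → ∃ λ y → emb y ≡ z
    emb-preimage {z} o =
      let z∈ = ∈-filter⁺ (T? ∘ occurs) (∈-allFin z) o in Any.index z∈ , sym (lookup-index z∈)

    activePart : Instance S
    activePart = record
      { dom = length occurring ; rel = λ R t → holds R (Vec.map emb t) ; covers = covers-active }
      where
      covers-active : ∀ y → Σ (Fin (size S)) λ R → Σ (Vec (Fin (length occurring)) (arity S R)) λ t →
                      T (holds R (Vec.map emb t)) × y ∈ᵥ t
      covers-active y =
        let R , t , h , y∈t = occurs-sound (emb-occurs y)
            pre = λ i → emb-preimage (occurs-complete h (∈ᵥ-lookup i t))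
            t≡  = tabulate-factor emb t (proj₁ ∘ pre) (proj₂ ∘ pre)
            _ , y′∈ , e = ∈ᵥ-map⁻ emb (subst (emb y ∈ᵥ_) t≡ y∈t)
        in R , tabulate (proj₁ ∘ pre) , subst (T ∘ holds R) t≡ h ,
           subst (_∈ᵥ tabulate (proj₁ ∘ pre)) (sym (emb-injective e)) y′∈

    factor-activePart : ∀ {F : Instance S} {f : Fin (dom F) → Fin n} →
                        (∀ R t → T (rel F R t) → T (holds R (Vec.map f t))) →
                        ∃ λ g → Hom F activePart g × (∀ x → emb (g x) ≡ f x)
    factor-activePart {F} {f} f-holds =
      proj₁ ∘ pre , hom g-holds , proj₂ ∘ pre
      where
      pre : ∀ x → ∃ λ y → emb y ≡ f x
      pre x = let R , t , r , x∈t = covers F x in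
        emb-preimage (occurs-complete (f-holds R t r) (∈ᵥ-map⁺ f x∈t))
      g-holds : ∀ R t → T (rel F R t) → T (holds R (Vec.map emb (Vec.map (proj₁ ∘ pre) t)))
      g-holds R t r = subst (T ∘ holds R) (sym (map-factor (proj₂ ∘ pre) t)) (f-holds R t r)

  productHolds : (A B : Instance S) → ∀ R → Vec (Fin (dom A * dom B)) (arity S R) → Bool
  productHolds A B R t = rel A R (Vec.map (proj₁ ∘ remQuot {dom A} (dom B)) t)
                       ∧ rel B R (Vec.map (proj₂ ∘ remQuot {dom A} (dom B)) t)

  infixr 7 _⊗_
  _⊗_ : Instance S → Instance S → Instance S
  A ⊗ B = ActivePart.activePart (dom A * dom B) (productHolds A B)

  module Product (A B : Instance S) where

    open ActivePart (dom A * dom B) (productHolds A B) using (emb; emb-injective; factor-activePart)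

    π₁ : Fin (dom (A ⊗ B)) → Fin (dom A)
    π₁ = proj₁ ∘ remQuot {dom A} (dom B) ∘ emb

    π₂ : Fin (dom (A ⊗ B)) → Fin (dom B)
    π₂ = proj₂ ∘ remQuot {dom A} (dom B) ∘ emb

    π₁-hom : Hom (A ⊗ B) A π₁
    π₁-hom = hom λ R t r → subst (T ∘ rel A R) (sym (Vec.map-∘ _ emb t)) (proj₁ (Equivalence.to T-∧ r))

    π₂-hom : Hom (A ⊗ B) B π₂
    π₂-hom = hom λ R t r →
      subst (T ∘ rel B R) (sym (Vec.map-∘ _ emb t)) (proj₂ (Equivalence.to (T-∧ {rel A R _}) r))

    π-injective : ∀ {x y} → π₁ x ≡ π₁ y → π₂ x ≡ π₂ y → x ≡ y
    π-injective {x} {y} e₁ e₂ = emb-injective (begin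
      emb x                   ≡⟨ combine-remQuot {dom A} (dom B) (emb x) ⟨
      combine (π₁ x) (π₂ x)   ≡⟨ cong₂ combine e₁ e₂ ⟩
      combine (π₁ y) (π₂ y)   ≡⟨ combine-remQuot {dom A} (dom B) (emb y) ⟩
      emb y                   ∎)
      where open ≡-Reasoning

    pair : ∀ {F f g} → Hom F A f → Hom F B g →
           ∃ λ h → Hom F (A ⊗ B) h × (∀ x → π₁ (h x) ≡ f x) × (∀ x → π₂ (h x) ≡ g x)
    pair {F} {f} {g} f-hom g-hom =
      let h , h-hom , emb∘h≗c = factor-activePart c-holds in
      h , h-hom , (λ x → trans (cong (proj₁ ∘ remQuot {dom A} (dom B)) (emb∘h≗c x)) (π₁∘c x))
                , (λ x → trans (cong (proj₂ ∘ remQuot {dom A} (dom B)) (emb∘h≗c x)) (π₂∘c x))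
      where
      c : Fin (dom F) → Fin (dom A * dom B)
      c x = combine (f x) (g x)
      π₁∘c : ∀ x → proj₁ (remQuot {dom A} (dom B) (c x)) ≡ f x
      π₁∘c x = cong proj₁ (remQuot-combine (f x) (g x))
      π₂∘c : ∀ x → proj₂ (remQuot {dom A} (dom B) (c x)) ≡ g x
      π₂∘c x = cong proj₂ (remQuot-combine (f x) (g x))
      c-holds : ∀ R t → T (rel F R t) → T (productHolds A B R (Vec.map c t))
      c-holds R t r = Equivalence.from T-∧
        ( subst (T ∘ rel A R) (sym (map-factor π₁∘c t)) (preserves f-hom R t r)
        , subst (T ∘ rel B R) (sym (map-factor π₂∘c t)) (preserves g-hom R t r))

    module _ (F : Instance S) where

      split : Vec (Fin (dom (A ⊗ B))) (dom F) → Vec (Fin (dom A)) (dom F) × Vec (Fin (dom B)) (dom F)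
      split h = Vec.map π₁ h , Vec.map π₂ h

      pairHoms : List (Vec (Fin (dom A)) (dom F) × Vec (Fin (dom B)) (dom F))
      pairHoms = List.cartesianProduct (homs F A) (homs F B)

      homs-⊗⇒ : ∀ {w} → w ∈ List.map split (homs F (A ⊗ B)) → w ∈ pairHoms
      homs-⊗⇒ w∈ with _ , h∈ , refl ← ∈-map⁻ split w∈ =
        ∈-cartesianProduct⁺ (∈-homs-map {F = F} π₁-hom h∈) (∈-homs-map {F = F} π₂-hom h∈)

      homs-⊗⇐ : ∀ {w} → w ∈ pairHoms → w ∈ List.map split (homs F (A ⊗ B))
      homs-⊗⇐ {w₁ , w₂} w∈ =
        let w₁∈ , w₂∈ = ∈-cartesianProduct⁻ (homs F A) (homs F B) w∈
            h , h-hom , π₁∘h , π₂∘h = pair (Equivalence.to (∈-homs F A) w₁∈) (Equivalence.to (∈-homs F B) w₂∈)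
        in subst (_∈ List.map split (homs F (A ⊗ B)))
             (sym (cong₂ _,_ (tabulate-factor π₁ w₁ h π₁∘h) (tabulate-factor π₂ w₂ h π₂∘h)))
             (∈-map⁺ split (Equivalence.from (∈-homs F (A ⊗ B))
                                              (Hom-cong (sym ∘ Vec.lookup∘tabulate h) h-hom)))

      split-unique : Unique (List.map split (homs F (A ⊗ B)))
      split-unique = Unique.map⁺ (λ e → map₂-injective π-injective (cong proj₁ e) (cong proj₂ e))
                                 (homs-unique F (A ⊗ B))

      homℕ-⊗ : homℕ F (A ⊗ B) ≡ homℕ F A * homℕ F B
      homℕ-⊗ = begin
        homℕ F (A ⊗ B)                             ≡⟨ homℕ≡length-homs F (A ⊗ B) ⟩
        length (homs F (A ⊗ B))                    ≡⟨ List.length-map split (homs F (A ⊗ B)) ⟨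
        length (List.map split (homs F (A ⊗ B)))   ≡⟨ length-≡ split-unique pairHoms-unique
                                                                (mk⇔ homs-⊗⇒ homs-⊗⇐) ⟩
        length pairHoms                            ≡⟨ length-cartesianProduct (homs F A) (homs F B) ⟩
        length (homs F A) * length (homs F B)      ≡⟨ cong₂ _*_ (homℕ≡length-homs F A)
                                                                (homℕ≡length-homs F B) ⟨
        homℕ F A * homℕ F B                        ∎
        where
        open ≡-Reasoning
        pairHoms-unique = Unique.cartesianProduct⁺ (homs-unique F A) (homs-unique F B)

  homEquiv-⊗ : ∀ {G W g} → Hom G W g → HomEquiv G (G ⊗ W)
  homEquiv-⊗ {G} {W} g-hom = let _ , h-hom , _ = Product.pair G W Hom-id g-hom in
    toHom h-hom , toHom (Product.π₁-hom G W)

-- Realising polynomials by instances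

  module _ (R₀ : Fin (size S)) where

    point : Instance S
    point = record
      { dom    = 1
      ; rel    = λ _ _ → true
      ; covers = λ { zero → R₀ , Vec.replicate _ zero , _ , zero∈ (arity-pos S R₀) }
      }
      where
      zero∈ : ∀ {k} → 1 ≤ k → zero ∈ᵥ Vec.replicate k (zero {0})
      zero∈ (s≤s _) = here refl

    Hom-point : ∀ {A f} → Hom A point f
    Hom-point = hom λ _ _ _ → _

    homℕ-point : ∀ F → homℕ F point ≡ 1
    homℕ-point F = homℕ-unique {A = F} (Vec.replicate _ zero) Hom-point constant
      where
      constant : ∀ {n} (h : Vec (Fin 1) n) → h ≡ Vec.replicate n zero
      constant []         = refl
      constant (zero ∷ h) = cong (zero ∷_) (constant h)

    realise : Poly → Instance S → Instance S
    realise one      Z = point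
    realise var      Z = Z
    realise (p :+ q) Z = realise p Z ⊕ realise q Z
    realise (p :* q) Z = realise p Z ⊗ realise q Z

    homℕ-realise : ∀ {F} → Connected F → Fin (dom F) → ∀ p Z → homℕ F (realise p Z) ≡ eval p (homℕ F Z)
    homℕ-realise {F} F-connected x₀ one      Z = homℕ-point F
    homℕ-realise {F} F-connected x₀ var      Z = refl
    homℕ-realise {F} F-connected x₀ (p :+ q) Z =
      trans (Coproduct.homℕ-⊕ (realise p Z) (realise q Z) F F-connected x₀)
            (cong₂ _+_ (homℕ-realise {F} F-connected x₀ p Z) (homℕ-realise {F} F-connected x₀ q Z))
    homℕ-realise {F} F-connected x₀ (p :* q) Z =
      trans (Product.homℕ-⊗ (realise p Z) (realise q Z) F)
            (cong₂ _*_ (homℕ-realise {F} F-connected x₀ p Z) (homℕ-realise {F} F-connected x₀ q Z))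

    point-to-lit : ∀ n Z → ∃ λ f → Hom point (realise (lit n) Z) f
    point-to-lit zero    Z = id , Hom-id
    point-to-lit (suc n) Z = _ , Coproduct.inl-hom point (realise (lit n) Z)

    weighted : List ℕ → Instance S → Instance S → Instance S
    weighted U Z Y = Z ⊗ (realise (lit (κ U)) Z ⊕ Y ⊗ (realise (recip⁺ U) Z ⊕ realise (recip⁻ U) Y))

    weighted-equiv : ∀ U Z Y → HomEquiv Z (weighted U Z Y)
    weighted-equiv U Z Y = homEquiv-⊗ {Z} {Kᵢ ⊕ Rᵢ}
      (Hom-∘ (Hom-∘ (Hom-point {Z} {λ _ → zero}) (proj₂ (point-to-lit (κ U) Z))) (Coproduct.inl-hom Kᵢ Rᵢ))
      where
      Kᵢ = realise (lit (κ U)) Z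
      Rᵢ = Y ⊗ (realise (recip⁺ U) Z ⊕ realise (recip⁻ U) Y)

    homℕ-weighted : ∀ U {F} → Connected F → Fin (dom F) → ∀ Z Y →
                    homℕ F (weighted U Z Y) ≡ homℕ F Z * weight U (homℕ F Z) (homℕ F Y)
    homℕ-weighted U {F} F-connected x₀ Z Y =
      trans (shape Z (realise (lit (κ U)) Z) Y (realise (recip⁺ U) Z) (realise (recip⁻ U) Y))
            (cong₂ (λ k n → homℕ F Z * (k + homℕ F Y * n))
                   (trans (count (lit (κ U)) Z) (eval-lit (κ U) (homℕ F Z)))
                   (cong₂ _+_ (count (recip⁺ U) Z) (count (recip⁻ U) Y)))
      where
      count = homℕ-realise {F} F-connected x₀
      shape : ∀ Z K Y P M →
              homℕ F (Z ⊗ (K ⊕ Y ⊗ (P ⊕ M))) ≡ homℕ F Z * (homℕ F K + homℕ F Y * (homℕ F P + homℕ F M))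
      shape Z K Y P M =
        trans (Product.homℕ-⊗ Z (K ⊕ Y ⊗ (P ⊕ M)) F) (cong (homℕ F Z *_)
          (trans (Coproduct.homℕ-⊕ K (Y ⊗ (P ⊕ M)) F F-connected x₀) (cong (homℕ F K +_)
            (trans (Product.homℕ-⊗ Y (P ⊕ M) F)
                   (cong (homℕ F Y *_) (Coproduct.homℕ-⊕ P M F F-connected x₀))))))

    weighted-balanced : ∀ U {F} → Connected F → ∀ Z Y → homℕ F Z ∈ U → homℕ F Y ∈ U →
                        hom𝔹 F Z ≡ hom𝔹 F Y → homℕ F (weighted U Z Y) ≡ homℕ F (weighted U Y Z)
    weighted-balanced U {F} F-connected Z Y z∈U y∈U 𝔹≡ = [ nonempty , empty ]′ (inhabited-or-zero (dom F))
      where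
      nonempty : Fin (dom F) → homℕ F (weighted U Z Y) ≡ homℕ F (weighted U Y Z)
      nonempty x₀ = begin
        homℕ F (weighted U Z Y)                    ≡⟨ homℕ-weighted U {F} F-connected x₀ Z Y ⟩
        homℕ F Z * weight U (homℕ F Z) (homℕ F Y)  ≡⟨ weight-balanced U z∈U y∈U 0<ᵇ≡ ⟩
        homℕ F Y * weight U (homℕ F Y) (homℕ F Z)  ≡⟨ homℕ-weighted U {F} F-connected x₀ Y Z ⟨
        homℕ F (weighted U Y Z)                    ∎
        where
        open ≡-Reasoning
        0<ᵇ≡ = trans (sym (hom𝔹≡0<ᵇhomℕ F Z)) (trans 𝔹≡ (hom𝔹≡0<ᵇhomℕ F Y))
      empty : dom F ≡ 0 → homℕ F (weighted U Z Y) ≡ homℕ F (weighted U Y Z)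
      empty dom≡0 =
        trans (homℕ-from-empty {F} (weighted U Z Y) dom≡0) (sym (homℕ-from-empty {F} (weighted U Y Z) dom≡0))

-- The zero pattern determines membership

  module _ {k} (F : Vec (Instance S) k) (F-connected : ∀ i → Connected (lookup F i)) where

    balance : ∀ {D₀ D} → hom𝔹-vec F D₀ ≡ hom𝔹-vec F D →
              ∃ λ A → ∃ λ B → HomEquiv D₀ A × HomEquiv D B × homℕ-vec F A ≡ homℕ-vec F B
    balance {D₀} {D} 𝔹≡ = [ weigh , keep ]′ (inhabited-or-zero (size S))
      where
      Balanced : Set
      Balanced = ∃ λ A → ∃ λ B → HomEquiv D₀ A × HomEquiv D B × homℕ-vec F A ≡ homℕ-vec F B
      counts : Instance S → Fin k → ℕ
      counts Z i = homℕ (lookup F i) Z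
      U : List ℕ
      U = List.map (counts D₀) (allFin k) ++ List.map (counts D) (allFin k)
      weigh : Fin (size S) → Balanced
      weigh R₀ =
        weighted R₀ U D₀ D , weighted R₀ U D D₀ , weighted-equiv R₀ U D₀ D , weighted-equiv R₀ U D D₀ ,
        map-cong-lookup F λ i → weighted-balanced R₀ U {lookup F i} (F-connected i) D₀ D
          (∈-++⁺ˡ (∈-map⁺ (counts D₀) (∈-allFin i)))
          (∈-++⁺ʳ (List.map (counts D₀) (allFin k)) (∈-map⁺ (counts D) (∈-allFin i)))
          (lookup-map-≡ 𝔹≡ i)
      keep : size S ≡ 0 → Balanced
      keep size≡0 = D₀ , D , HomEquiv-refl {A = D₀} , HomEquiv-refl {A = D} , map-cong-lookup F λ i →
        trans (homℕ-from-empty {F = lookup F i} D₀ (empty-schema size≡0 (lookup F i)))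
              (sym (homℕ-from-empty {F = lookup F i} D (empty-schema size≡0 (lookup F i))))

    hom𝔹-vec-determines : ∀ {C : Instance S → Set} {X} → ClosedUnderHomEquiv C → LeftQueryℕ C F X →
                          ∀ {D₀ D} → hom𝔹-vec F D₀ ≡ hom𝔹-vec F D → C D₀ → C D
    hom𝔹-vec-determines {C} {X} closed decides {D₀} {D} 𝔹≡ c₀ =
      let A , B , D₀≈A , D≈B , ℕ≡ = balance {D₀} {D} 𝔹≡ in
      closed B D (swap D≈B) (Equivalence.from (decides B)
        (subst X ℕ≡ (Equivalence.to (decides A) (closed D₀ A D₀≈A c₀))))

theorem18 : (S : Schema) (C : Instance S → Set) → ClosedUnderHomEquiv C →
            (k : ℕ) (F : Vec (Instance S) k) → (∀ (i : Fin k) → Connected (lookup F i)) →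
            (Σ (Vec ℕ k → Set) λ X → LeftQueryℕ C F X) ⇔ (Σ (Vec Bool k → Set) λ X′ → LeftQuery𝔹 C F X′)
theorem18 S C closed k F F-connected = mk⇔ toBool toℕ
  where
  toBool : (Σ (Vec ℕ k → Set) λ X → LeftQueryℕ C F X) → (Σ (Vec Bool k → Set) λ X′ → LeftQuery𝔹 C F X′)
  toBool (X , decides) = (λ b → ∃ λ D₀ → C D₀ × hom𝔹-vec F D₀ ≡ b) , λ D →
    mk⇔ (λ c → D , c , refl)
        (λ (_ , c₀ , 𝔹≡) → hom𝔹-vec-determines F F-connected {C} {X} closed decides 𝔹≡ c₀)
  toℕ : (Σ (Vec Bool k → Set) λ X′ → LeftQuery𝔹 C F X′) → (Σ (Vec ℕ k → Set) λ X → LeftQueryℕ C F X)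
  toℕ (X′ , decides) = X′ ∘ Vec.map (0 <ᵇ_) , λ D → subst (λ b → C D ⇔ X′ b) (hom𝔹-vec≡ F D) (decides D)
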